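{- Let $m\ge 3$ be an odd integer. Then the graph $G_{\alpha}(m;1,1,1)$ is a snark, i.e., it is a cubic graph that admits no proper $3$-edge-coloring.
   Context: Let $G$ be the graph with the 11 vertices $A,B,A',B',v,x_1,\dots,x_6$ and the 14 edges $Av,\ vA',\ Ax_6,\ x_6x_2,\ x_6x_5,\ x_2x_4,\ x_2B,\ x_4x_3,\ x_4B',\ x_3A',\ x_3x_5,\ x_5x_1,\ x_1B,\ x_1B'$ (so $A,B,A',B',v$ have degree 2 and $x_1,\dots,x_6$ have degree 3). For integers $m\ge 3$, $a,b$ with $1\le a,b\le m-1$ and $c$ with $1\le c<m/2$, the graph $G_{\alpha}(m;a,b,c)$ has vertex set $\{u_i: u\in V(G),\ i\in\mathbb{Z}_m\}\cup\{w_i: i\in\mathbb{Z}_m\}$ and edges: $u_iu'_i$ for every edge $uu'$ of $G$ and every $i$; the spoke edges $v_iw_i$; the loop edges $w_iw_{i+c}$; and the connecting edges $A'_iA_{i+a}$ and $B'_iB_{i+b}$ (all indices modulo $m$). It is a cubic graph on $12m$ vertices. A snark is a cubic graph whose chromatic index is 4. -}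

module Defs where

open import Data.Nat using (ℕ; zero; suc; _+_; _*_; _≤_)
open import Data.Nat.DivMod using (_mod_)
open import Data.Fin using (Fin; toℕ)
open import Data.Product using (Σ; _×_; _,_)
open import Data.Sum using (_⊎_)
open import Data.List using (List; length)
open import Data.List.Membership.Propositional using (_∈_)
open import Data.List.Relation.Unary.Unique.Propositional using (Unique)
open import Relation.Binary.PropositionalEquality using (_≡_; _≢_)
open import Relation.Nullary using (¬_)
open import Function.Bundles using (_⇔_)

-- The 12 "base" vertices: the 11 vertices of G plus w.
data Base : Set where
  A B A' B' v x₁ x₂ x₃ x₄ x₅ x₆ w : Base

data GEdge : Base → Base → Set where
  e-Av    : GEdge A v
  e-vA'   : GEdge v A'
  e-Ax₆   : GEdge A x₆
  e-x₆x₂  : GEdge x₆ x₂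
  e-x₆x₅  : GEdge x₆ x₅
  e-x₂x₄  : GEdge x₂ x₄
  e-x₂B   : GEdge x₂ B
  e-x₄x₃  : GEdge x₄ x₃
  e-x₄B'  : GEdge x₄ B'
  e-x₃A'  : GEdge x₃ A'
  e-x₃x₅  : GEdge x₃ x₅
  e-x₅x₁  : GEdge x₅ x₁
  e-x₁B   : GEdge x₁ B
  e-x₁B'  : GEdge x₁ B'

-- Vertex set of G_α(m;a,b,c): u_i is (u , i), i ∈ ℤ_m ≅ Fin m.
V : ℕ → Set
V m = Base × Fin m

shift : {m : ℕ} → ℕ → Fin m → Fin m
shift {zero}  k ()
shift {suc n} k i = (toℕ i + k) mod (suc n)

data Edge (m a b c : ℕ) : V m → V m → Set where
  copy    : ∀ {u u'} → GEdge u u' → (i : Fin m) → Edge m a b c (u , i) (u' , i)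
  spoke   : (i : Fin m) → Edge m a b c (v , i) (w , i)
  loop    : (i : Fin m) → Edge m a b c (w , i) (w , shift c i)
  connA   : (i : Fin m) → Edge m a b c (A' , i) (A , shift a i)
  connB   : (i : Fin m) → Edge m a b c (B' , i) (B , shift b i)

Gα : (m a b c : ℕ) → V m → V m → Set
Gα m a b c x y = Edge m a b c x y ⊎ Edge m a b c y x

IsCubic : {X : Set} → (X → X → Set) → Set
IsCubic {X} Adj =
  (∀ x → ¬ Adj x x) ×
  (∀ x → Σ (List X) λ ns → length ns ≡ 3 × Unique ns × (∀ y → Adj x y ⇔ y ∈ ns))

Proper3EdgeColouring : {X : Set} → (X → X → Set) → Set
Proper3EdgeColouring {X} Adj =
  Σ (∀ x y → Adj x y → Fin 3) λ col →
    (∀ x y (p : Adj x y) (q : Adj y x) → col x y p ≡ col y x q) ×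
    (∀ x y z (p : Adj x y) (q : Adj x z) → y ≢ z → col x y p ≢ col x z q)

IsSnark : {X : Set} → (X → X → Set) → Set
IsSnark Adj = IsCubic Adj × ¬ Proper3EdgeColouring Adj

-- Cut G_α(m;1,1,1) into m slices, slice i consisting of the copy G_i together with w_i. A slice is
-- joined to the next one by exactly three edges, A'_iA_{i+1}, B'_iB_{i+1} and w_iw_{i+1}. A finite
-- check shows that for every proper 3-edge-colouring of a slice the "orientation" of the colours on
-- its three outgoing edges is the opposite of that on its three incoming edges. Going once around the
-- cycle of slices the orientation therefore flips m times, which is impossible when m is odd.
module Submission where

open import Defs
open import Data.Nat using (ℕ; zero; suc; _+_; _*_; _%_; _/_; _≡ᵇ_; _≤_; s≤s; z≤n)
open import Data.Nat.Properties using (+-assoc; +-comm; +-cancelˡ-≡; *-suc)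
open import Data.Nat.DivMod using (_mod_; m%n<n; m%n%n≡m%n; %-distribˡ-+; [m+n]%n≡m%n; m<n⇒m%n≡m; n%n≡0; m≡m%n+[m/n]*n)
open import Data.Nat.Divisibility using (_∣_; divides; ∣⇒≤)
open import Data.Fin using (Fin; toℕ; zero; #_)
open import Data.Fin.Properties using (toℕ-fromℕ<; toℕ-injective; toℕ<n; all?) renaming (_≟_ to _≟ᶠ_)
open import Data.Bool using (Bool; not)
open import Data.Bool.Properties using (not-involutive; not-¬) renaming (_≟_ to _≟ᵇ_)
open import Data.Maybe using (Maybe; just; nothing; fromMaybe)
open import Data.Vec using (Vec; lookup; replicate; _[_]≔_)
open import Data.List using (List; []; _∷_; map; length)
open import Data.List.Relation.Unary.Any using (here; there)
open import Data.List.Relation.Unary.All using ([]; _∷_)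
open import Data.List.Relation.Unary.AllPairs using ([]; _∷_)
open import Data.List.Membership.Propositional using (_∈_)
open import Data.List.Relation.Unary.Unique.Propositional using (Unique)
open import Data.List.Relation.Unary.Unique.DecPropositional (_≟ᶠ_ {3}) using (unique?)
open import Data.Product using (Σ; _×_; _,_; proj₁; proj₂)
open import Data.Sum using (_⊎_; inj₁; inj₂)
open import Data.Unit using (⊤; tt)
open import Data.Empty using (⊥)
open import Function.Bundles using (mk⇔)
open import Relation.Binary.PropositionalEquality using (_≡_; _≢_; refl; sym; trans; cong; subst; module ≡-Reasoning)
open import Relation.Nullary using (¬_; Dec; _→-dec_)
open import Relation.Nullary.Decidable using (from-yes)
open import Relation.Unary using (Decidable)

open ≡-Reasoning

-- Cyclic shifts on ℤ_m

module _ {n : ℕ} where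

  toℕ-mod : ∀ t → toℕ (t mod suc n) ≡ t % suc n
  toℕ-mod t = toℕ-fromℕ< (m%n<n t (suc n))

  toℕ-shift : ∀ k (i : Fin (suc n)) → toℕ (shift k i) ≡ (toℕ i + k) % suc n
  toℕ-shift k i = toℕ-mod (toℕ i + k)

  shift-mod : ∀ k t → shift k (t mod suc n) ≡ (t + k) mod suc n
  shift-mod k t = toℕ-injective (begin
    toℕ (shift k (t mod suc n))     ≡⟨ toℕ-shift k (t mod suc n) ⟩
    (toℕ (t mod suc n) + k) % suc n ≡⟨ cong (λ x → (x + k) % suc n) (toℕ-mod t) ⟩
    (t % suc n + k) % suc n         ≡⟨ %-distribˡ-+ (t % suc n) k (suc n) ⟩
    (t % suc n % suc n + k % suc n) % suc n
      ≡⟨ cong (λ x → (x + k % suc n) % suc n) (m%n%n≡m%n t (suc n)) ⟩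
    (t % suc n + k % suc n) % suc n ≡⟨ %-distribˡ-+ t k (suc n) ⟨
    (t + k) % suc n                 ≡⟨ toℕ-mod (t + k) ⟨
    toℕ ((t + k) mod suc n)         ∎)

  shift-shift : ∀ j k (i : Fin (suc n)) → shift j (shift k i) ≡ shift (k + j) i
  shift-shift j k i = trans (shift-mod j (toℕ i + k)) (cong (_mod suc n) (+-assoc (toℕ i) k j))

  shift-period : ∀ (i : Fin (suc n)) → shift (suc n) i ≡ i
  shift-period i = toℕ-injective (begin
    toℕ (shift (suc n) i)   ≡⟨ toℕ-shift (suc n) i ⟩
    (toℕ i + suc n) % suc n ≡⟨ [m+n]%n≡m%n (toℕ i) (suc n) ⟩
    toℕ i % suc n           ≡⟨ m<n⇒m%n≡m (toℕ<n i) ⟩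
    toℕ i                   ∎)

  shift-fixed⇒∣ : ∀ k (i : Fin (suc n)) → shift k i ≡ i → suc n ∣ k
  shift-fixed⇒∣ k i fixed = divides ((toℕ i + k) / suc n) (+-cancelˡ-≡ (toℕ i) _ _ (begin
    toℕ i + k                                         ≡⟨ m≡m%n+[m/n]*n (toℕ i + k) (suc n) ⟩
    (toℕ i + k) % suc n + (toℕ i + k) / suc n * suc n
      ≡⟨ cong (_+ (toℕ i + k) / suc n * suc n) (trans (sym (toℕ-shift k i)) (cong toℕ fixed)) ⟩
    toℕ i + (toℕ i + k) / suc n * suc n               ∎))

  mod-self : suc n mod suc n ≡ zero
  mod-self = toℕ-injective (trans (toℕ-mod (suc n)) (n%n≡0 (suc n)))

next prev : ∀ {n} → Fin (suc n) → Fin (suc n)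
next = shift 1
prev {n} = shift n

next-prev : ∀ {n} (i : Fin (suc n)) → next (prev i) ≡ i
next-prev {n} i = trans (shift-shift 1 n i) (trans (cong (λ k → shift k i) (+-comm n 1)) (shift-period i))

prev-next : ∀ {n} (i : Fin (suc n)) → prev (next i) ≡ i
prev-next {n} i = trans (shift-shift n 1 i) (shift-period i)

next-mod : ∀ {n} t → next (t mod suc n) ≡ suc t mod suc n
next-mod {n} t = trans (shift-mod 1 t) (cong (_mod suc n) (+-comm t 1))

module _ {n : ℕ} (i : Fin (3 + n)) where

  next≢id : next i ≢ i
  next≢id fixed with ∣⇒≤ (shift-fixed⇒∣ 1 i fixed)
  ... | s≤s ()

  next²≢id : next (next i) ≢ i
  next²≢id fixed with ∣⇒≤ (shift-fixed⇒∣ 2 i (trans (sym (shift-shift 1 1 i)) fixed))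
  ... | s≤s (s≤s ())

  next≢prev : next i ≢ prev i
  next≢prev eq = next²≢id (trans (cong next eq) (next-prev i))

module _ (f : ℕ → Bool) (alternates : ∀ t → f (suc t) ≡ not (f t)) where

  alternating-even : ∀ k → f (2 * k) ≡ f 0
  alternating-even zero    = refl
  alternating-even (suc k) = begin
    f (2 * suc k)         ≡⟨ cong f (*-suc 2 k) ⟩
    f (2 + 2 * k)         ≡⟨ alternates (1 + 2 * k) ⟩
    not (f (1 + 2 * k))   ≡⟨ cong not (alternates (2 * k)) ⟩
    not (not (f (2 * k))) ≡⟨ not-involutive _ ⟩
    f (2 * k)             ≡⟨ alternating-even k ⟩
    f 0                   ∎

  alternating-odd-aperiodic : ∀ k → f (1 + 2 * k) ≢ f 0
  alternating-odd-aperiodic k periodic =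
    not-¬ (sym (alternating-even k)) (trans (sym periodic) (alternates (2 * k)))

-- Exhaustive search for edge colourings of a small graph
--
-- The edges E are stored at positions `index e` of a vector of partial colours, and the vertices X
-- are visited in a list order: at each vertex its uncoloured edges are given every colour and the
-- local condition Ok is checked, which prunes the search; Goal is checked on the finished colouring.
module ExhaustiveSearch
  {E C X : Set} {n : ℕ} (index : E → Fin n)
  (blank : C) (∀? : ∀ {P : C → Set} → Decidable P → Dec (∀ c → P c))
  (star : X → List E)
  (Ok : X → (E → C) → Set) (ok? : ∀ u κ → Dec (Ok u κ))
  (Goal : (E → C) → Set) (goal? : ∀ κ → Dec (Goal κ)) where

  Partial : Set
  Partial = Vec (Maybe C) n

  -- `blank` is a junk value, read only at edges that are still uncoloured.
  _‼_ : Partial → E → C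
  σ ‼ e = fromMaybe blank (lookup σ (index e))

  Extend : List E → Partial → (Partial → Set) → Set
  Extend []       σ K = K σ
  Extend (e ∷ es) σ K with lookup σ (index e)
  ... | just _  = Extend es σ K
  ... | nothing = ∀ c → Extend es (σ [ index e ]≔ just c) K

  extend? : ∀ {K} → (∀ σ → Dec (K σ)) → ∀ es σ → Dec (Extend es σ K)
  extend? K? []       σ = K? σ
  extend? K? (e ∷ es) σ with lookup σ (index e)
  ... | just _  = extend? K? es σ
  ... | nothing = ∀? λ c → extend? K? es (σ [ index e ]≔ just c)

  fill : (E → C) → List E → Partial → Partial
  fill κ []       σ = σ
  fill κ (e ∷ es) σ with lookup σ (index e)
  ... | just _  = fill κ es σ
  ... | nothing = fill κ es (σ [ index e ]≔ just (κ e))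

  extend-fill : ∀ {K} κ es σ → Extend es σ K → K (fill κ es σ)
  extend-fill κ []       σ k = k
  extend-fill κ (e ∷ es) σ k with lookup σ (index e)
  ... | just _  = extend-fill κ es σ k
  ... | nothing = extend-fill κ es _ (k (κ e))

  Search : List X → Partial → Set
  Search []       σ = Goal (σ ‼_)
  Search (u ∷ us) σ = Extend (star u) σ λ σ′ → Ok u (σ′ ‼_) → Search us σ′

  search? : ∀ us σ → Dec (Search us σ)
  search? []       σ = goal? (σ ‼_)
  search? (u ∷ us) σ = extend? (λ σ′ → ok? u (σ′ ‼_) →-dec search? us σ′) (star u) σ

  fillAll : (E → C) → List X → Partial → Partial
  fillAll κ []       σ = σ
  fillAll κ (u ∷ us) σ = fillAll κ us (fill κ (star u) σ)

  Along : (E → C) → List X → Partial → Set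
  Along κ []       σ = ⊤
  Along κ (u ∷ us) σ = Ok u (fill κ (star u) σ ‼_) × Along κ us (fill κ (star u) σ)

  -- For a concrete graph, `fillAll κ us σ ‼ e` computes to `κ e`, so the conclusion is Goal κ.
  search-along : ∀ κ us σ → Search us σ → Along κ us σ → Goal (fillAll κ us σ ‼_)
  search-along κ []       σ s _           = s
  search-along κ (u ∷ us) σ s (ok , along) =
    search-along κ us _ (extend-fill κ (star u) σ s ok) along

-- The slice gadget

Colour : Set
Colour = Fin 3

-- inA, inB, inW are the edges A'_{i-1}A_i, B'_{i-1}B_i, w_{i-1}w_i entering slice i,
-- and outA, outB, outW the edges A'_iA_{i+1}, B'_iB_{i+1}, w_iw_{i+1} leaving it.
data SliceEdge : Set where
  inner : ∀ {u u′} → GEdge u u′ → SliceEdge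
  spoke inA inB inW outA outB outW : SliceEdge

star : Base → List SliceEdge
star A  = inA ∷ inner e-Av ∷ inner e-Ax₆ ∷ []
star B  = inB ∷ inner e-x₂B ∷ inner e-x₁B ∷ []
star A' = inner e-vA' ∷ inner e-x₃A' ∷ outA ∷ []
star B' = inner e-x₄B' ∷ inner e-x₁B' ∷ outB ∷ []
star v  = inner e-Av ∷ inner e-vA' ∷ spoke ∷ []
star w  = inW ∷ spoke ∷ outW ∷ []
star x₁ = inner e-x₅x₁ ∷ inner e-x₁B ∷ inner e-x₁B' ∷ []
star x₂ = inner e-x₆x₂ ∷ inner e-x₂x₄ ∷ inner e-x₂B ∷ []
star x₃ = inner e-x₄x₃ ∷ inner e-x₃A' ∷ inner e-x₃x₅ ∷ []
star x₄ = inner e-x₂x₄ ∷ inner e-x₄x₃ ∷ inner e-x₄B' ∷ []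
star x₅ = inner e-x₆x₅ ∷ inner e-x₃x₅ ∷ inner e-x₅x₁ ∷ []
star x₆ = inner e-Ax₆ ∷ inner e-x₆x₂ ∷ inner e-x₆x₅ ∷ []

Rainbow : Base → (SliceEdge → Colour) → Set
Rainbow u κ = Unique (map κ (star u))

-- Reading colours in ℤ₃: for three distinct colours it tells whether (a, b, c) is an even permutation,
-- otherwise whether the lone colour is one more than the repeated one (then a + b + c = 1).
orientation : Colour → Colour → Colour → Bool
orientation a b c with (toℕ a + toℕ b + toℕ c) % 3
... | zero = (toℕ a + 1) % 3 ≡ᵇ toℕ b
... | s    = s ≡ᵇ 1

Flips : (SliceEdge → Colour) → Set
Flips κ = orientation (κ outA) (κ outB) (κ outW) ≡ not (orientation (κ inA) (κ inB) (κ inW))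

sliceIndex : SliceEdge → Fin 21
sliceIndex (inner e-Av)   = # 0
sliceIndex (inner e-vA')  = # 1
sliceIndex (inner e-Ax₆)  = # 2
sliceIndex (inner e-x₆x₂) = # 3
sliceIndex (inner e-x₆x₅) = # 4
sliceIndex (inner e-x₂x₄) = # 5
sliceIndex (inner e-x₂B)  = # 6
sliceIndex (inner e-x₄x₃) = # 7
sliceIndex (inner e-x₄B') = # 8
sliceIndex (inner e-x₃A') = # 9
sliceIndex (inner e-x₃x₅) = # 10
sliceIndex (inner e-x₅x₁) = # 11
sliceIndex (inner e-x₁B)  = # 12
sliceIndex (inner e-x₁B') = # 13
sliceIndex spoke          = # 14
sliceIndex inA            = # 15
sliceIndex inB            = # 16
sliceIndex inW            = # 17
sliceIndex outA           = # 18
sliceIndex outB           = # 19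
sliceIndex outW           = # 20

open ExhaustiveSearch sliceIndex zero all? star Rainbow (λ u κ → unique? (map κ (star u)))
  Flips (λ κ → _ ≟ᵇ _)

slice-flips : ∀ κ → (∀ u → Rainbow u κ) → Flips κ
slice-flips κ rainbow =
  search-along κ order uncoloured (from-yes (search? order uncoloured))
    (rainbow A , rainbow v , rainbow w , rainbow x₆ , rainbow x₂ , rainbow B , rainbow x₁ ,
     rainbow x₅ , rainbow x₃ , rainbow x₄ , rainbow B' , rainbow A' , tt)
  where
    order : List Base
    order = A ∷ v ∷ w ∷ x₆ ∷ x₂ ∷ B ∷ x₁ ∷ x₅ ∷ x₃ ∷ x₄ ∷ B' ∷ A' ∷ []
    uncoloured : Partial
    uncoloured = replicate 21 nothing

-- G_α(m;1,1,1) is cubic for m ≥ 3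

module Cubicity (n : ℕ) where

  private
    M : ℕ
    M = 3 + n

  neighbours : V M → List (V M)
  neighbours (A  , i) = (v , i)  ∷ (x₆ , i) ∷ (A' , prev i) ∷ []
  neighbours (B  , i) = (x₂ , i) ∷ (x₁ , i) ∷ (B' , prev i) ∷ []
  neighbours (A' , i) = (v , i)  ∷ (x₃ , i) ∷ (A , next i)  ∷ []
  neighbours (B' , i) = (x₄ , i) ∷ (x₁ , i) ∷ (B , next i)  ∷ []
  neighbours (v  , i) = (A , i)  ∷ (A' , i) ∷ (w , i)       ∷ []
  neighbours (x₁ , i) = (x₅ , i) ∷ (B , i)  ∷ (B' , i)      ∷ []
  neighbours (x₂ , i) = (x₆ , i) ∷ (x₄ , i) ∷ (B , i)       ∷ []
  neighbours (x₃ , i) = (x₄ , i) ∷ (A' , i) ∷ (x₅ , i)      ∷ []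
  neighbours (x₄ , i) = (x₂ , i) ∷ (x₃ , i) ∷ (B' , i)      ∷ []
  neighbours (x₅ , i) = (x₆ , i) ∷ (x₃ , i) ∷ (x₁ , i)      ∷ []
  neighbours (x₆ , i) = (A , i)  ∷ (x₂ , i) ∷ (x₅ , i)      ∷ []
  neighbours (w  , i) = (v , i)  ∷ (w , next i) ∷ (w , prev i) ∷ []

  adjacent⇒neighbour : ∀ {x y} → Gα M 1 1 1 x y → y ∈ neighbours x
  adjacent⇒neighbour (inj₁ (copy e-Av   i)) = here refl
  adjacent⇒neighbour (inj₁ (copy e-vA'  i)) = there (here refl)
  adjacent⇒neighbour (inj₁ (copy e-Ax₆  i)) = there (here refl)
  adjacent⇒neighbour (inj₁ (copy e-x₆x₂ i)) = there (here refl)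
  adjacent⇒neighbour (inj₁ (copy e-x₆x₅ i)) = there (there (here refl))
  adjacent⇒neighbour (inj₁ (copy e-x₂x₄ i)) = there (here refl)
  adjacent⇒neighbour (inj₁ (copy e-x₂B  i)) = there (there (here refl))
  adjacent⇒neighbour (inj₁ (copy e-x₄x₃ i)) = there (here refl)
  adjacent⇒neighbour (inj₁ (copy e-x₄B' i)) = there (there (here refl))
  adjacent⇒neighbour (inj₁ (copy e-x₃A' i)) = there (here refl)
  adjacent⇒neighbour (inj₁ (copy e-x₃x₅ i)) = there (there (here refl))
  adjacent⇒neighbour (inj₁ (copy e-x₅x₁ i)) = there (there (here refl))
  adjacent⇒neighbour (inj₁ (copy e-x₁B  i)) = there (here refl)
  adjacent⇒neighbour (inj₁ (copy e-x₁B' i)) = there (there (here refl))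
  adjacent⇒neighbour (inj₁ (spoke i))       = there (there (here refl))
  adjacent⇒neighbour (inj₁ (loop i))        = there (here refl)
  adjacent⇒neighbour (inj₁ (connA i))       = there (there (here refl))
  adjacent⇒neighbour (inj₁ (connB i))       = there (there (here refl))
  adjacent⇒neighbour (inj₂ (copy e-Av   i)) = here refl
  adjacent⇒neighbour (inj₂ (copy e-vA'  i)) = here refl
  adjacent⇒neighbour (inj₂ (copy e-Ax₆  i)) = here refl
  adjacent⇒neighbour (inj₂ (copy e-x₆x₂ i)) = here refl
  adjacent⇒neighbour (inj₂ (copy e-x₆x₅ i)) = here refl
  adjacent⇒neighbour (inj₂ (copy e-x₂x₄ i)) = here refl
  adjacent⇒neighbour (inj₂ (copy e-x₂B  i)) = here refl
  adjacent⇒neighbour (inj₂ (copy e-x₄x₃ i)) = here refl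
  adjacent⇒neighbour (inj₂ (copy e-x₄B' i)) = here refl
  adjacent⇒neighbour (inj₂ (copy e-x₃A' i)) = there (here refl)
  adjacent⇒neighbour (inj₂ (copy e-x₃x₅ i)) = there (here refl)
  adjacent⇒neighbour (inj₂ (copy e-x₅x₁ i)) = here refl
  adjacent⇒neighbour (inj₂ (copy e-x₁B  i)) = there (here refl)
  adjacent⇒neighbour (inj₂ (copy e-x₁B' i)) = there (here refl)
  adjacent⇒neighbour (inj₂ (spoke i))       = here refl
  adjacent⇒neighbour (inj₂ (loop i))        = there (there (here (cong (w ,_) (sym (prev-next i)))))
  adjacent⇒neighbour (inj₂ (connA i))       = there (there (here (cong (A' ,_) (sym (prev-next i)))))
  adjacent⇒neighbour (inj₂ (connB i))       = there (there (here (cong (B' ,_) (sym (prev-next i)))))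

  arriving : ∀ {u u′} → (∀ j → Edge M 1 1 1 (u′ , j) (u , next j)) → ∀ i → Edge M 1 1 1 (u′ , prev i) (u , i)
  arriving {u} {u′} edge i = subst (λ j → Edge M 1 1 1 (u′ , prev i) (u , j)) (next-prev i) (edge (prev i))

  neighbour⇒adjacent : ∀ x {y} → y ∈ neighbours x → Gα M 1 1 1 x y
  neighbour⇒adjacent (A  , i) (here refl)                 = inj₁ (copy e-Av i)
  neighbour⇒adjacent (A  , i) (there (here refl))         = inj₁ (copy e-Ax₆ i)
  neighbour⇒adjacent (A  , i) (there (there (here refl))) = inj₂ (arriving connA i)
  neighbour⇒adjacent (B  , i) (here refl)                 = inj₂ (copy e-x₂B i)
  neighbour⇒adjacent (B  , i) (there (here refl))         = inj₂ (copy e-x₁B i)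
  neighbour⇒adjacent (B  , i) (there (there (here refl))) = inj₂ (arriving connB i)
  neighbour⇒adjacent (A' , i) (here refl)                 = inj₂ (copy e-vA' i)
  neighbour⇒adjacent (A' , i) (there (here refl))         = inj₂ (copy e-x₃A' i)
  neighbour⇒adjacent (A' , i) (there (there (here refl))) = inj₁ (connA i)
  neighbour⇒adjacent (B' , i) (here refl)                 = inj₂ (copy e-x₄B' i)
  neighbour⇒adjacent (B' , i) (there (here refl))         = inj₂ (copy e-x₁B' i)
  neighbour⇒adjacent (B' , i) (there (there (here refl))) = inj₁ (connB i)
  neighbour⇒adjacent (v  , i) (here refl)                 = inj₂ (copy e-Av i)
  neighbour⇒adjacent (v  , i) (there (here refl))         = inj₁ (copy e-vA' i)
  neighbour⇒adjacent (v  , i) (there (there (here refl))) = inj₁ (spoke i)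
  neighbour⇒adjacent (x₁ , i) (here refl)                 = inj₂ (copy e-x₅x₁ i)
  neighbour⇒adjacent (x₁ , i) (there (here refl))         = inj₁ (copy e-x₁B i)
  neighbour⇒adjacent (x₁ , i) (there (there (here refl))) = inj₁ (copy e-x₁B' i)
  neighbour⇒adjacent (x₂ , i) (here refl)                 = inj₂ (copy e-x₆x₂ i)
  neighbour⇒adjacent (x₂ , i) (there (here refl))         = inj₁ (copy e-x₂x₄ i)
  neighbour⇒adjacent (x₂ , i) (there (there (here refl))) = inj₁ (copy e-x₂B i)
  neighbour⇒adjacent (x₃ , i) (here refl)                 = inj₂ (copy e-x₄x₃ i)
  neighbour⇒adjacent (x₃ , i) (there (here refl))         = inj₁ (copy e-x₃A' i)
  neighbour⇒adjacent (x₃ , i) (there (there (here refl))) = inj₁ (copy e-x₃x₅ i)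
  neighbour⇒adjacent (x₄ , i) (here refl)                 = inj₂ (copy e-x₂x₄ i)
  neighbour⇒adjacent (x₄ , i) (there (here refl))         = inj₁ (copy e-x₄x₃ i)
  neighbour⇒adjacent (x₄ , i) (there (there (here refl))) = inj₁ (copy e-x₄B' i)
  neighbour⇒adjacent (x₅ , i) (here refl)                 = inj₂ (copy e-x₆x₅ i)
  neighbour⇒adjacent (x₅ , i) (there (here refl))         = inj₂ (copy e-x₃x₅ i)
  neighbour⇒adjacent (x₅ , i) (there (there (here refl))) = inj₁ (copy e-x₅x₁ i)
  neighbour⇒adjacent (x₆ , i) (here refl)                 = inj₂ (copy e-Ax₆ i)
  neighbour⇒adjacent (x₆ , i) (there (here refl))         = inj₁ (copy e-x₆x₂ i)
  neighbour⇒adjacent (x₆ , i) (there (there (here refl))) = inj₁ (copy e-x₆x₅ i)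
  neighbour⇒adjacent (w  , i) (here refl)                 = inj₂ (spoke i)
  neighbour⇒adjacent (w  , i) (there (here refl))         = inj₁ (loop i)
  neighbour⇒adjacent (w  , i) (there (there (here refl))) = inj₂ (arriving loop i)

  neighbours-unique : ∀ x → Unique (neighbours x)
  neighbours-unique (A  , i) = ((λ ()) ∷ (λ ()) ∷ []) ∷ ((λ ()) ∷ []) ∷ [] ∷ []
  neighbours-unique (B  , i) = ((λ ()) ∷ (λ ()) ∷ []) ∷ ((λ ()) ∷ []) ∷ [] ∷ []
  neighbours-unique (A' , i) = ((λ ()) ∷ (λ ()) ∷ []) ∷ ((λ ()) ∷ []) ∷ [] ∷ []
  neighbours-unique (B' , i) = ((λ ()) ∷ (λ ()) ∷ []) ∷ ((λ ()) ∷ []) ∷ [] ∷ []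
  neighbours-unique (v  , i) = ((λ ()) ∷ (λ ()) ∷ []) ∷ ((λ ()) ∷ []) ∷ [] ∷ []
  neighbours-unique (x₁ , i) = ((λ ()) ∷ (λ ()) ∷ []) ∷ ((λ ()) ∷ []) ∷ [] ∷ []
  neighbours-unique (x₂ , i) = ((λ ()) ∷ (λ ()) ∷ []) ∷ ((λ ()) ∷ []) ∷ [] ∷ []
  neighbours-unique (x₃ , i) = ((λ ()) ∷ (λ ()) ∷ []) ∷ ((λ ()) ∷ []) ∷ [] ∷ []
  neighbours-unique (x₄ , i) = ((λ ()) ∷ (λ ()) ∷ []) ∷ ((λ ()) ∷ []) ∷ [] ∷ []
  neighbours-unique (x₅ , i) = ((λ ()) ∷ (λ ()) ∷ []) ∷ ((λ ()) ∷ []) ∷ [] ∷ []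
  neighbours-unique (x₆ , i) = ((λ ()) ∷ (λ ()) ∷ []) ∷ ((λ ()) ∷ []) ∷ [] ∷ []
  neighbours-unique (w  , i) = ((λ ()) ∷ (λ ()) ∷ []) ∷ ((λ eq → next≢prev i (cong proj₂ eq)) ∷ []) ∷ [] ∷ []

  GEdge-irreflexive : ∀ {u} → ¬ GEdge u u
  GEdge-irreflexive ()

  edge⇒distinct : ∀ {x y} → Edge M 1 1 1 x y → x ≢ y
  edge⇒distinct (copy e i) refl = GEdge-irreflexive e
  edge⇒distinct (spoke i)  ()
  edge⇒distinct (loop i)   eq = next≢id i (sym (cong proj₂ eq))
  edge⇒distinct (connA i)  ()
  edge⇒distinct (connB i)  ()

  length-neighbours : ∀ x → length (neighbours x) ≡ 3
  length-neighbours (A  , i) = refl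
  length-neighbours (B  , i) = refl
  length-neighbours (A' , i) = refl
  length-neighbours (B' , i) = refl
  length-neighbours (v  , i) = refl
  length-neighbours (x₁ , i) = refl
  length-neighbours (x₂ , i) = refl
  length-neighbours (x₃ , i) = refl
  length-neighbours (x₄ , i) = refl
  length-neighbours (x₅ , i) = refl
  length-neighbours (x₆ , i) = refl
  length-neighbours (w  , i) = refl

  cubic : IsCubic (Gα M 1 1 1)
  cubic = (λ { x (inj₁ e) → edge⇒distinct e refl ; x (inj₂ e) → edge⇒distinct e refl })
        , λ x → neighbours x , length-neighbours x , neighbours-unique x
              , λ y → mk⇔ adjacent⇒neighbour (neighbour⇒adjacent x)

module EdgeColouring {X : Set} (R : X → X → Set) (χ : Proper3EdgeColouring λ x y → R x y ⊎ R y x) where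

  private
    col = proj₁ χ
    col-sym = proj₁ (proj₂ χ)
    col-proper = proj₂ (proj₂ χ)

  colour : ∀ {x y} → R x y ⊎ R y x → Colour
  colour {x} {y} (inj₁ e) = col x y (inj₁ e)
  colour {x} {y} (inj₂ e) = col y x (inj₁ e)

  colour≡col : ∀ {x y} (p : R x y ⊎ R y x) → colour p ≡ col x y p
  colour≡col (inj₁ e) = refl
  colour≡col (inj₂ e) = col-sym _ _ (inj₁ e) (inj₂ e)

  colour-distinct : ∀ {x y z} (p : R x y ⊎ R y x) (q : R x z ⊎ R z x) → y ≢ z → colour p ≢ colour q
  colour-distinct p q y≢z eq =
    col-proper _ _ _ p q y≢z (trans (sym (colour≡col p)) (trans eq (colour≡col q)))

  rainbow-at : ∀ {x y₁ y₂ y₃} (p₁ : R x y₁ ⊎ R y₁ x) (p₂ : R x y₂ ⊎ R y₂ x) (p₃ : R x y₃ ⊎ R y₃ x) →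
               y₁ ≢ y₂ → y₁ ≢ y₃ → y₂ ≢ y₃ → Unique (colour p₁ ∷ colour p₂ ∷ colour p₃ ∷ [])
  rainbow-at p₁ p₂ p₃ d₁₂ d₁₃ d₂₃ =
    (colour-distinct p₁ p₂ d₁₂ ∷ colour-distinct p₁ p₃ d₁₃ ∷ []) ∷ (colour-distinct p₂ p₃ d₂₃ ∷ []) ∷ [] ∷ []

-- No proper 3-edge-colouring of G_α(m;1,1,1) for odd m ≥ 3

module Uncolourable {n : ℕ} (χ : Proper3EdgeColouring (Gα (3 + n) 1 1 1)) where

  open EdgeColouring (Edge (3 + n) 1 1 1) χ

  -- The slice at index next j, entered from slice j.
  slice : Fin (3 + n) → SliceEdge → Colour
  slice j (inner e) = colour (inj₁ (copy e (next j)))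
  slice j spoke     = colour (inj₁ (spoke (next j)))
  slice j inA       = colour (inj₁ (connA j))
  slice j inB       = colour (inj₁ (connB j))
  slice j inW       = colour (inj₁ (loop j))
  slice j outA      = colour (inj₁ (connA (next j)))
  slice j outB      = colour (inj₁ (connB (next j)))
  slice j outW      = colour (inj₁ (loop (next j)))

  slice-rainbow : ∀ j u → Rainbow u (slice j)
  slice-rainbow j A  = rainbow-at (inj₂ (connA j)) (inj₁ (copy e-Av _)) (inj₁ (copy e-Ax₆ _)) (λ ()) (λ ()) (λ ())
  slice-rainbow j B  = rainbow-at (inj₂ (connB j)) (inj₂ (copy e-x₂B _)) (inj₂ (copy e-x₁B _)) (λ ()) (λ ()) (λ ())
  slice-rainbow j A' = rainbow-at (inj₂ (copy e-vA' _)) (inj₂ (copy e-x₃A' _)) (inj₁ (connA (next j))) (λ ()) (λ ()) (λ ())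
  slice-rainbow j B' = rainbow-at (inj₂ (copy e-x₄B' _)) (inj₂ (copy e-x₁B' _)) (inj₁ (connB (next j))) (λ ()) (λ ()) (λ ())
  slice-rainbow j v  = rainbow-at (inj₂ (copy e-Av _)) (inj₁ (copy e-vA' _)) (inj₁ (spoke _)) (λ ()) (λ ()) (λ ())
  slice-rainbow j w  = rainbow-at (inj₂ (loop j)) (inj₂ (spoke _)) (inj₁ (loop (next j)))
                         (λ ()) (λ eq → next²≢id j (sym (cong proj₂ eq))) (λ ())
  slice-rainbow j x₁ = rainbow-at (inj₂ (copy e-x₅x₁ _)) (inj₁ (copy e-x₁B _)) (inj₁ (copy e-x₁B' _)) (λ ()) (λ ()) (λ ())
  slice-rainbow j x₂ = rainbow-at (inj₂ (copy e-x₆x₂ _)) (inj₁ (copy e-x₂x₄ _)) (inj₁ (copy e-x₂B _)) (λ ()) (λ ()) (λ ())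
  slice-rainbow j x₃ = rainbow-at (inj₂ (copy e-x₄x₃ _)) (inj₁ (copy e-x₃A' _)) (inj₁ (copy e-x₃x₅ _)) (λ ()) (λ ()) (λ ())
  slice-rainbow j x₄ = rainbow-at (inj₂ (copy e-x₂x₄ _)) (inj₁ (copy e-x₄x₃ _)) (inj₁ (copy e-x₄B' _)) (λ ()) (λ ()) (λ ())
  slice-rainbow j x₅ = rainbow-at (inj₂ (copy e-x₆x₅ _)) (inj₂ (copy e-x₃x₅ _)) (inj₁ (copy e-x₅x₁ _)) (λ ()) (λ ()) (λ ())
  slice-rainbow j x₆ = rainbow-at (inj₂ (copy e-Ax₆ _)) (inj₁ (copy e-x₆x₂ _)) (inj₁ (copy e-x₆x₅ _)) (λ ()) (λ ()) (λ ())

  crossing : Fin (3 + n) → Bool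
  crossing j = orientation (colour (inj₁ (connA j))) (colour (inj₁ (connB j))) (colour (inj₁ (loop j)))

  crossing-alternates : ∀ t → crossing (suc t mod (3 + n)) ≡ not (crossing (t mod (3 + n)))
  crossing-alternates t =
    subst (λ j → crossing j ≡ not (crossing (t mod (3 + n)))) (next-mod t)
      (slice-flips (slice (t mod (3 + n))) (slice-rainbow (t mod (3 + n))))

  odd-length-impossible : ∀ k → 3 + n ≡ 1 + 2 * k → ⊥
  odd-length-impossible k odd =
    alternating-odd-aperiodic (λ t → crossing (t mod (3 + n))) crossing-alternates k
      (subst (λ m → crossing (m mod (3 + n)) ≡ crossing zero) odd (cong crossing mod-self))

theorem2 : (m : ℕ) → 3 ≤ m → Σ ℕ (λ k → m ≡ 1 + 2 * k) → IsSnark (Gα m 1 1 1)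
theorem2 (suc (suc (suc n))) (s≤s (s≤s (s≤s z≤n))) (k , odd) =
  Cubicity.cubic n , λ χ → Uncolourable.odd-length-impossible χ k odd
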